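{- Let $X$ be a finite set of cardinality $k$ and let $f\in\mathrm{Bool}(X)$ be indecomposable and hyper-rigid. Then $\Phi(\overline f)=T(T-1)\cdots(T-k+1)$.
   Context: A boolean function on $X$ is $f:\mathcal{P}(X)\to\mathbb{Z}$ with $f(\emptyset)=0$; $\mathrm{Bool}(X)$ is their set; $\overline f$ is its isomorphism class. $f_{\mid Y}$ is restriction to $\mathcal{P}(Y)$. For disjoint $X,Y$: $f\star_1 g(A)=f(A\cap X)+g(A\cap Y)$. For nonempty $X$, $f$ is indecomposable if $f=f'\star_1 f''$ with $f'\in\mathrm{Bool}(X\setminus Y)$, $f''\in\mathrm{Bool}(Y)$ forces $Y\in\{\emptyset,X\}$. An indecomposable $f$ is hyper-rigid if $f(A\sqcup B)\ne f(A)+f(B)$ for all nonempty disjoint $A,B\subseteq X$. $f$ is modular if $f(A)=\sum_{x\in A}f(\{x\})$ for all $A$; $\epsilon_\delta(f)=1$ if $f$ is modular, $0$ otherwise. With $\binom{T}{k}=T(T-1)\cdots(T-k+1)/k!$, for $X\ne\emptyset$, \[\Phi(\overline f)=\sum_{j\ge1}\ \sum_{\substack{(X_1,\dots,X_j)\\ X=X_1\sqcup\cdots\sqcup X_j,\ X_i\ne\emptyset}}\epsilon_\delta(f_{\mid X_1})\cdots\epsilon_\delta(f_{\mid X_j})\binom{T}{j}\in\mathbb{K}[T].\] -}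

module Defs where

open import Data.Nat using (ℕ; zero; suc; _≤_; _!)
open import Data.Nat.Properties using (_!≢0)
open import Data.Integer as ℤ using (ℤ)
open import Data.Rational as ℚ using (ℚ)
open import Data.Bool using (Bool; true; false; if_then_else_; _∧_; not)
import Data.Bool.Properties as BoolP
open import Data.Fin using (Fin; zero; suc; _≟_)
open import Data.Fin.Subset using (Subset; ⊥; ⊤; ⁅_⁆; _∩_; _∪_; ∁; Nonempty)
open import Data.Vec using (Vec; []; _∷_; lookup)
open import Data.Vec.Properties using (≡-dec)
open import Data.List using (List; []; _∷_; [_]; _++_; map; concatMap; filter; foldr; allFin; upTo)
open import Data.Product using (_×_)
open import Data.Sum using (_⊎_)
open import Relation.Nullary using (¬_; does)
open import Relation.Nullary.Decidable using (⌊_⌋)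
open import Relation.Binary.PropositionalEquality using (_≡_; _≢_)

-- X is modelled as Fin k, P(X) as Subset k, Bool(X) as functions
-- f : Subset k → ℤ together with the hypothesis f ⊥ ≡ 0.

_≟ₛ_ : ∀ {k} (A B : Subset k) → Relation.Nullary.Dec (A ≡ B)
_≟ₛ_ = ≡-dec BoolP._≟_

-- f ⋆₁ g on the decomposition X = (X ∖ Y) ⊔ Y, for f' ∈ Bool(X∖Y),
-- f'' ∈ Bool(Y); only the values of f' on subsets of X∖Y and of f''
-- on subsets of Y are ever used.
star₁ : ∀ {k} (Y : Subset k) (f' f'' : Subset k → ℤ) → Subset k → ℤ
star₁ Y f' f'' A = f' (A ∩ ∁ Y) ℤ.+ f'' (A ∩ Y)

Indecomposable : ∀ {k} → (Subset k → ℤ) → Set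
Indecomposable {k} f =
  (1 ≤ k) ×
  (∀ (Y : Subset k) (f' f'' : Subset k → ℤ) → f' ⊥ ≡ ℤ.0ℤ → f'' ⊥ ≡ ℤ.0ℤ →
     (∀ A → f A ≡ star₁ Y f' f'' A) → (Y ≡ ⊥) ⊎ (Y ≡ ⊤))

HyperRigid : ∀ {k} → (Subset k → ℤ) → Set
HyperRigid {k} f =
  Indecomposable f ×
  (∀ (A B : Subset k) → Nonempty A → Nonempty B → A ∩ B ≡ ⊥ →
     f (A ∪ B) ≢ f A ℤ.+ f B)

allB : ∀ {A : Set} → (A → Bool) → List A → Bool
allB p = foldr (λ x b → p x ∧ b) true

sumℤ : List ℤ → ℤ
sumℤ = foldr ℤ._+_ ℤ.0ℤ

allSubsets : ∀ n → List (Subset n)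
allSubsets zero    = [ [] ]
allSubsets (suc n) = map (true ∷_) (allSubsets n) ++ map (false ∷_) (allSubsets n)

subsetsOf : ∀ {k} → Subset k → List (Subset k)
subsetsOf {k} Y = filter (λ A → (A ∩ Y) ≟ₛ A) (allSubsets k)

sumSingletons : ∀ {k} → (Subset k → ℤ) → Subset k → ℤ
sumSingletons {k} f A =
  sumℤ (map (λ x → if lookup A x then f ⁅ x ⁆ else ℤ.0ℤ) (allFin k))

ModularOn : ∀ {k} → (Subset k → ℤ) → Subset k → Set
ModularOn {k} f Y = ∀ (A : Subset k) → A ∩ Y ≡ A → f A ≡ sumSingletons f A

εδ : ∀ {k} → (Subset k → ℤ) → Subset k → ℚ
εδ f Y =
  if allB (λ A → ⌊ f A ℤ.≟ sumSingletons f A ⌋) (subsetsOf Y) then ℚ.1ℚ else ℚ.0ℚ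

allTuples : ∀ {k} j → List (Vec (Subset k) j)
allTuples zero    = [ [] ]
allTuples {k} (suc j) =
  concatMap (λ A → map (A ∷_) (allTuples j)) (allSubsets k)

isOrderedPartition : ∀ {k j} → Vec (Subset k) j → Bool
isOrderedPartition {k} {j} Xs =
  allB (λ i → not ⌊ lookup Xs i ≟ₛ ⊥ ⌋) (allFin j) ∧
  allB (λ i → allB (λ i' → ⌊ i ≟ i' ⌋ Data.Bool.∨ ⌊ (lookup Xs i ∩ lookup Xs i') ≟ₛ ⊥ ⌋)
                 (allFin j)) (allFin j) ∧
  ⌊ foldr _∪_ ⊥ (Data.List.map (lookup Xs) (allFin j)) ≟ₛ ⊤ ⌋

orderedPartitions : ∀ k j → List (Vec (Subset k) j)
orderedPartitions k j = filter (λ Xs → isOrderedPartition Xs BoolP.≟ true)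
                               (allTuples j)

-- polynomials in ℚ[T] as coefficient lists (constant term first)

Poly : Set
Poly = List ℚ

coeff : Poly → ℕ → ℚ
coeff []       _       = ℚ.0ℚ
coeff (c ∷ p)  zero    = c
coeff (c ∷ p)  (suc n) = coeff p n

_≈ₚ_ : Poly → Poly → Set
p ≈ₚ q = ∀ n → coeff p n ≡ coeff q n

_+ₚ_ : Poly → Poly → Poly
[]      +ₚ q       = q
(a ∷ p) +ₚ []      = a ∷ p
(a ∷ p) +ₚ (b ∷ q) = (a ℚ.+ b) ∷ (p +ₚ q)

scale : ℚ → Poly → Poly
scale c = map (c ℚ.*_)

0ₚ : Poly
0ₚ = []

mulLin : ℚ → Poly → Poly
mulLin c p = (ℚ.0ℚ ∷ p) +ₚ scale (ℚ.- c) p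

fallingFactorial : ℕ → Poly
fallingFactorial zero    = [ ℚ.1ℚ ]
fallingFactorial (suc j) = mulLin (ℤ.+ j ℚ./ 1) (fallingFactorial j)

binomT : ℕ → Poly
binomT j = scale ((ℤ.+ 1 ℚ./ (j !)) {{j !≢0}}) (fallingFactorial j)

sumₚ : List Poly → Poly
sumₚ = foldr _+ₚ_ 0ₚ

prodℚ : List ℚ → ℚ
prodℚ = foldr ℚ._*_ ℚ.1ℚ

-- Φ(f̄) = Σ_{j ≥ 1} Σ_{(X₁,…,X_j)} ε_δ(f|X₁)⋯ε_δ(f|X_j) binom(T,j).
-- Only j ≤ k contribute (j nonempty disjoint blocks in a k-set), so
-- j ranges over 1,…,k.
Φ : ∀ {k} → (Subset k → ℤ) → Poly
Φ {k} f =
  sumₚ (map (λ j →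
    sumₚ (map (λ Xs → scale (prodℚ (map (λ i → εδ f (lookup Xs i)) (allFin (suc j))))
                            (binomT (suc j)))
              (orderedPartitions k (suc j))))
    (upTo k))

{-# OPTIONS --safe #-}

-- Every f with f ∅ = 0 is modular
-- on a singleton, whereas a hyper-rigid f is modular on no A containing two points x ≠ y, since
-- modularity would give f A = f {x} + f (A ∖ {x}).  Hence in Φ only the ordered partitions into
-- singletons carry weight, and all of them have j = k blocks.  Peeling off the first block, the
-- weighted number N(U, m) of ordered partitions of U into m blocks satisfies
-- N(U, m+1) = Σ_{x ∈ U} N(U ∖ {x}, m), so N(U, m) = m! if |U| = m and 0 otherwise.  Therefore
-- Φ(f̄) = k! binom(T, k) = T(T-1)⋯(T-k+1).

module Submission where

open import Defs
open import Data.Nat using (ℕ)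
open import Data.Integer using (ℤ; 0ℤ)
open import Data.Fin.Subset using (Subset; ⊥)
open import Relation.Binary.PropositionalEquality using (_≡_)

open import Data.Bool using (Bool; true; false; T; not; _∧_; _∨_; if_then_else_)
import Data.Bool.Properties as Boolₚ
open import Data.Bool.Properties using (T-∧; T-∨; T-≡)
open import Data.Nat as ℕ using (zero; suc; _!)
import Data.Nat.Properties as ℕₚ
import Data.Integer as ℤ
import Data.Integer.Properties as ℤₚ
open import Data.Rational as ℚ using (ℚ; 0ℚ; 1ℚ; _+_; _*_)
import Data.Rational.Properties as ℚₚ
import Data.Rational.Unnormalised as ℚᵘ
import Data.Rational.Unnormalised.Properties as ℚᵘₚ
open import Data.Fin as Fin using (Fin; zero; suc)
import Data.Fin.Properties as Finₚ
open import Data.Fin.Subset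
open import Data.Fin.Subset.Properties
open import Data.Vec using (Vec; _∷_; []; lookup; here; there)
open import Data.List using (List; []; _∷_; _++_; map; concatMap; filter; allFin; upTo)
import Data.List.Properties as Listₚ
open import Data.List.Membership.Propositional using () renaming (_∈_ to _∈ₗ_)
open import Data.List.Membership.Propositional.Properties
  using (∈-map⁺; ∈-++⁺ˡ; ∈-++⁺ʳ; ∈-filter⁺; ∈-filter⁻; ∈-upTo⁻)
open import Data.List.Relation.Unary.All as All using (All; []; _∷_)
import Data.List.Relation.Unary.All.Properties as All
open import Data.List.Relation.Unary.Any as Any using (Any)
import Data.List.Relation.Unary.Any.Properties as Any
open import Data.Product using (∃; ∃₂; _×_; _,_; uncurry; proj₁; proj₂)
import Data.Product as Product
open import Data.Product.Function.NonDependent.Propositional using (_×-⇔_)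
open import Data.Sum as Sum using (_⊎_; inj₁; inj₂; [_,_]′)
open import Data.Empty using (⊥-elim)
open import Function using (_∘_; id; flip; _⇔_; mk⇔; Equivalence)
import Function.Properties.Equivalence as ⇔
open import Level using (0ℓ)
open import Relation.Nullary using (¬_; Dec; does; yes; no; ¬?; _×-dec_; contradiction)
open import Relation.Nullary.Decidable as Dec
  using (⌊_⌋; T?; toWitness; fromWitness; toWitnessFalse; fromWitnessFalse; decidable-stable;
         does-⇔; dec-true; dec-false)
open import Relation.Unary using (Pred)
open import Relation.Binary.PropositionalEquality
  using (_≢_; refl; sym; trans; cong; cong₂; subst; module ≡-Reasoning)

private
  variable
    A B : Set
    n : ℕ
    p q : Subset n
    x y : Fin n

∑ : List A → (A → ℚ) → ℚ
∑ []      g = 0ℚ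
∑ (x ∷ L) g = g x + ∑ L g

∑-cong : ∀ (L : List A) {g h : A → ℚ} → (∀ {x} → x ∈ₗ L → g x ≡ h x) → ∑ L g ≡ ∑ L h
∑-cong []      g≗h = refl
∑-cong (x ∷ L) g≗h = cong₂ _+_ (g≗h (Any.here refl)) (∑-cong L (g≗h ∘ Any.there))

∑-zero : ∀ (L : List A) → ∑ L (λ _ → 0ℚ) ≡ 0ℚ
∑-zero []      = refl
∑-zero (x ∷ L) = trans (ℚₚ.+-identityˡ _) (∑-zero L)

∑-++ : ∀ (L M : List A) g → ∑ (L ++ M) g ≡ ∑ L g + ∑ M g
∑-++ []      M g = sym (ℚₚ.+-identityˡ _)
∑-++ (x ∷ L) M g = trans (cong (g x +_) (∑-++ L M g)) (sym (ℚₚ.+-assoc (g x) _ _))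

∑-*ˡ : ∀ (L : List A) c g → ∑ L (λ x → c * g x) ≡ c * ∑ L g
∑-*ˡ []      c g = sym (ℚₚ.*-zeroʳ c)
∑-*ˡ (x ∷ L) c g = trans (cong (c * g x +_) (∑-*ˡ L c g)) (sym (ℚₚ.*-distribˡ-+ c (g x) _))

∑-*ʳ : ∀ (L : List A) c g → ∑ L (λ x → g x * c) ≡ ∑ L g * c
∑-*ʳ []      c g = sym (ℚₚ.*-zeroˡ c)
∑-*ʳ (x ∷ L) c g = trans (cong (g x * c +_) (∑-*ʳ L c g)) (sym (ℚₚ.*-distribʳ-+ c (g x) _))

∑-filter : ∀ {P : Pred A 0ℓ} (P? : ∀ x → Dec (P x)) L g →
           ∑ (filter P? L) g ≡ ∑ L (λ x → if does (P? x) then g x else 0ℚ)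
∑-filter P? []      g = refl
∑-filter P? (x ∷ L) g with does (P? x)
... | true  = cong (g x +_) (∑-filter P? L g)
... | false = trans (∑-filter P? L g) (sym (ℚₚ.+-identityˡ _))

∑-map : ∀ (f : A → B) L g → ∑ (map f L) g ≡ ∑ L (g ∘ f)
∑-map f []      g = refl
∑-map f (x ∷ L) g = cong (g (f x) +_) (∑-map f L g)

∑-concatMap : ∀ (f : A → List B) L g → ∑ (concatMap f L) g ≡ ∑ L (λ x → ∑ (f x) g)
∑-concatMap f []      g = refl
∑-concatMap f (x ∷ L) g =
  trans (∑-++ (f x) (concatMap f L) g) (cong (∑ (f x) g +_) (∑-concatMap f L g))

map-allFin-suc : ∀ (g : Fin (suc n) → A) → map g (allFin (suc n)) ≡ g zero ∷ map (g ∘ suc) (allFin n)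
map-allFin-suc g = cong (g zero ∷_)
  (trans (Listₚ.map-tabulate suc g) (sym (Listₚ.map-tabulate id (g ∘ suc))))

∑-allFin-suc : ∀ (g : Fin (suc n) → ℚ) → ∑ (allFin (suc n)) g ≡ g zero + ∑ (allFin n) (g ∘ suc)
∑-allFin-suc {n} g = cong (g zero +_)
  (trans (cong (λ L → ∑ L g) (sym (Listₚ.map-tabulate id suc))) (∑-map suc (allFin n) g))

∑-upTo-≟ : ∀ m (g : ℕ → ℚ) → ∑ (upTo (suc m)) (λ j → if does (m ℕ.≟ j) then g j else 0ℚ) ≡ g m
∑-upTo-≟ m g = begin
  ∑ (upTo (suc m)) h        ≡⟨ cong (λ L → ∑ L h) (Listₚ.applyUpTo-∷ʳ id m) ⟨
  ∑ (upTo m ++ m ∷ []) h    ≡⟨ ∑-++ (upTo m) (m ∷ []) h ⟩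
  ∑ (upTo m) h + (h m + 0ℚ) ≡⟨ cong₂ _+_ (trans (∑-cong (upTo m) below) (∑-zero (upTo m)))
                                         (ℚₚ.+-identityʳ (h m)) ⟩
  0ℚ + h m                  ≡⟨ ℚₚ.+-identityˡ (h m) ⟩
  h m                       ≡⟨ cong (if_then g m else 0ℚ) (dec-true (m ℕ.≟ m) refl) ⟩
  g m                       ∎
  where
  open ≡-Reasoning
  h : ℕ → ℚ
  h j = if does (m ℕ.≟ j) then g j else 0ℚ
  below : ∀ {j} → j ∈ₗ upTo m → h j ≡ 0ℚ
  below {j} j∈upTo = cong (if_then g j else 0ℚ) (dec-false (m ℕ.≟ j) (ℕₚ.>⇒≢ (∈-upTo⁻ j∈upTo)))

if-∧-* : ∀ b c (a x : ℚ) →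
         (if b ∧ c then a * x else 0ℚ) ≡ (if b then a else 0ℚ) * (if c then x else 0ℚ)
if-∧-* true  true  a x = refl
if-∧-* true  false a x = sym (ℚₚ.*-zeroʳ a)
if-∧-* false c     a x = sym (ℚₚ.*-zeroˡ (if c then x else 0ℚ))

if-*ʳ : ∀ b (a c : ℚ) → (if b then a else 0ℚ) * c ≡ (if b then a * c else 0ℚ)
if-*ʳ true  a c = refl
if-*ʳ false a c = ℚₚ.*-zeroˡ c

fromℕ : ℕ → ℚ
fromℕ n = ℤ.+ n ℚ./ 1

module _ where
  open import Relation.Binary.Reasoning.Setoid ℚᵘₚ.≃-setoid

  private
    toℚᵘ-fromℕ : ∀ n → ℚ.toℚᵘ (fromℕ n) ℚᵘ.≃ ℚᵘ.mkℚᵘ (ℤ.+ n) 0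
    toℚᵘ-fromℕ n = ℚₚ.toℚᵘ-fromℚᵘ (ℚᵘ.mkℚᵘ (ℤ.+ n) 0)

  fromℕ-+ : ∀ m n → fromℕ (m ℕ.+ n) ≡ fromℕ m + fromℕ n
  fromℕ-+ m n = ℚₚ.toℚᵘ-injective (begin
    ℚ.toℚᵘ (fromℕ (m ℕ.+ n))                   ≈⟨ toℚᵘ-fromℕ (m ℕ.+ n) ⟩
    ℚᵘ.mkℚᵘ (ℤ.+ m ℤ.+ ℤ.+ n) 0                ≈⟨ ℚᵘ.*≡* (cong (ℤ._* ℤ.1ℤ) (sym (cong₂ ℤ._+_
                                                     (ℤₚ.*-identityʳ (ℤ.+ m)) (ℤₚ.*-identityʳ (ℤ.+ n))))) ⟩
    ℚᵘ.mkℚᵘ (ℤ.+ m) 0 ℚᵘ.+ ℚᵘ.mkℚᵘ (ℤ.+ n) 0  ≈⟨ ℚᵘₚ.+-cong (toℚᵘ-fromℕ m) (toℚᵘ-fromℕ n) ⟨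
    ℚ.toℚᵘ (fromℕ m) ℚᵘ.+ ℚ.toℚᵘ (fromℕ n)      ≈⟨ ℚₚ.toℚᵘ-homo-+ (fromℕ m) (fromℕ n) ⟨
    ℚ.toℚᵘ (fromℕ m + fromℕ n)                  ∎)

  fromℕ-* : ∀ m n → fromℕ (m ℕ.* n) ≡ fromℕ m * fromℕ n
  fromℕ-* m n = ℚₚ.toℚᵘ-injective (begin
    ℚ.toℚᵘ (fromℕ (m ℕ.* n))                   ≈⟨ toℚᵘ-fromℕ (m ℕ.* n) ⟩
    ℚᵘ.mkℚᵘ (ℤ.+ (m ℕ.* n)) 0                  ≈⟨ ℚᵘ.*≡* (cong (ℤ._* ℤ.1ℤ) (ℤₚ.pos-* m n)) ⟩
    ℚᵘ.mkℚᵘ (ℤ.+ m) 0 ℚᵘ.* ℚᵘ.mkℚᵘ (ℤ.+ n) 0  ≈⟨ ℚᵘₚ.*-cong (toℚᵘ-fromℕ m) (toℚᵘ-fromℕ n) ⟨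
    ℚ.toℚᵘ (fromℕ m) ℚᵘ.* ℚ.toℚᵘ (fromℕ n)      ≈⟨ ℚₚ.toℚᵘ-homo-* (fromℕ m) (fromℕ n) ⟨
    ℚ.toℚᵘ (fromℕ m * fromℕ n)                  ∎)

  fromℕ-*-1/ : ∀ n .{{_ : ℕ.NonZero n}} → fromℕ n * (ℤ.+ 1 ℚ./ n) ≡ 1ℚ
  fromℕ-*-1/ n@(suc n-1) = ℚₚ.toℚᵘ-injective (begin
    ℚ.toℚᵘ (fromℕ n * (ℤ.+ 1 ℚ./ n))             ≈⟨ ℚₚ.toℚᵘ-homo-* (fromℕ n) _ ⟩
    ℚ.toℚᵘ (fromℕ n) ℚᵘ.* ℚ.toℚᵘ (ℤ.+ 1 ℚ./ n)   ≈⟨ ℚᵘₚ.*-cong (toℚᵘ-fromℕ n)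
                                                     (ℚₚ.toℚᵘ-fromℚᵘ (ℚᵘ.mkℚᵘ (ℤ.+ 1) n-1)) ⟩
    ℚᵘ.mkℚᵘ (ℤ.+ n) 0 ℚᵘ.* ℚᵘ.mkℚᵘ (ℤ.+ 1) n-1  ≈⟨ ℚᵘ.*≡* n·1·1≡1·n ⟩
    ℚᵘ.1ℚᵘ                                      ∎)
    where
    n·1·1≡1·n : (ℤ.+ n ℤ.* ℤ.1ℤ) ℤ.* ℤ.1ℤ ≡ ℤ.1ℤ ℤ.* ℤ.+ (1 ℕ.* n)
    n·1·1≡1·n = trans (ℤₚ.*-identityʳ (ℤ.+ n ℤ.* ℤ.1ℤ)) (trans (ℤₚ.*-identityʳ (ℤ.+ n))
                  (trans (cong ℤ.+_ (sym (ℕₚ.*-identityˡ n))) (sym (ℤₚ.*-identityˡ (ℤ.+ (1 ℕ.* n))))))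

coeff-+ₚ : ∀ p q n → coeff (p +ₚ q) n ≡ coeff p n + coeff q n
coeff-+ₚ []      q       n       = sym (ℚₚ.+-identityˡ _)
coeff-+ₚ (a ∷ p) []      n       = sym (ℚₚ.+-identityʳ _)
coeff-+ₚ (a ∷ p) (b ∷ q) zero    = refl
coeff-+ₚ (a ∷ p) (b ∷ q) (suc n) = coeff-+ₚ p q n

coeff-scale : ∀ c p n → coeff (scale c p) n ≡ c * coeff p n
coeff-scale c []      n       = sym (ℚₚ.*-zeroʳ c)
coeff-scale c (a ∷ p) zero    = refl
coeff-scale c (a ∷ p) (suc n) = coeff-scale c p n

coeff-sumₚ : ∀ ps n → coeff (sumₚ ps) n ≡ ∑ ps (λ p → coeff p n)
coeff-sumₚ []       n = refl
coeff-sumₚ (p ∷ ps) n = trans (coeff-+ₚ p (sumₚ ps) n) (cong (coeff p n +_) (coeff-sumₚ ps n))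

fromℕ[k!]*binomT : ∀ k n → fromℕ (k !) * coeff (binomT k) n ≡ coeff (fallingFactorial k) n
fromℕ[k!]*binomT k n = begin
  fromℕ (k !) * coeff (binomT k) n      ≡⟨ cong (fromℕ (k !) *_) (coeff-scale c (fallingFactorial k) n) ⟩
  fromℕ (k !) * (c * coeff ff n)        ≡⟨ ℚₚ.*-assoc (fromℕ (k !)) c (coeff ff n) ⟨
  fromℕ (k !) * c * coeff ff n          ≡⟨ cong (_* coeff ff n) (fromℕ-*-1/ (k !) {{k ℕₚ.!≢0}}) ⟩
  1ℚ * coeff ff n                       ≡⟨ ℚₚ.*-identityˡ (coeff ff n) ⟩
  coeff ff n                            ∎
  where
  open ≡-Reasoning
  ff : Poly
  ff = fallingFactorial k
  c : ℚ
  c = (ℤ.+ 1 ℚ./ (k !)) {{k ℕₚ.!≢0}}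

T-allB : ∀ {p : A → Bool} (L : List A) → T (allB p L) ⇔ All (T ∘ p) L
T-allB []      = mk⇔ (λ _ → []) (λ _ → _)
T-allB (x ∷ L) = ⇔.trans T-∧ (mk⇔ (λ (px , pL) → px ∷ Equivalence.to (T-allB L) pL)
                                  (λ { (px ∷ pL) → px , Equivalence.from (T-allB L) pL }))

T-allB-allFin : ∀ (p : Fin n → Bool) → T (allB p (allFin n)) ⇔ (∀ i → T (p i))
T-allB-allFin {n} p = ⇔.trans (T-allB (allFin n)) (mk⇔ All.tabulate⁻ All.tabulate⁺)

∣p∣≡0⇒p≡⊥ : ∣ p ∣ ≡ 0 → p ≡ ⊥
∣p∣≡0⇒p≡⊥ {p = []}        _     = refl
∣p∣≡0⇒p≡⊥ {p = false ∷ p} ∣p∣≡0 = cong (false ∷_) (∣p∣≡0⇒p≡⊥ ∣p∣≡0)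

p≡⊥⇒∣p∣≡0 : p ≡ ⊥ → ∣ p ∣ ≡ 0
p≡⊥⇒∣p∣≡0 {n} refl = ∣⊥∣≡0 n

∣p∣≡1⇒p≡⁅x⁆ : ∣ p ∣ ≡ 1 → ∃ λ x → p ≡ ⁅ x ⁆
∣p∣≡1⇒p≡⁅x⁆ {p = true  ∷ p} ∣p∣≡1 = zero , cong (true ∷_) (∣p∣≡0⇒p≡⊥ (cong ℕ.pred ∣p∣≡1))
∣p∣≡1⇒p≡⁅x⁆ {p = false ∷ p} ∣p∣≡1 = Product.map suc (cong (false ∷_)) (∣p∣≡1⇒p≡⁅x⁆ ∣p∣≡1)

p≢⊥⇒Nonempty : p ≢ ⊥ → Nonempty p
p≢⊥⇒Nonempty {p = p} p≢⊥ = decidable-stable (nonempty? p) (p≢⊥ ∘ Empty-unique)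

p≢⊥∧∣p∣≢1⇒pair : p ≢ ⊥ → ∣ p ∣ ≢ 1 → ∃₂ λ x y → x ≢ y × x ∈ p × y ∈ p
p≢⊥∧∣p∣≢1⇒pair {p = []}         []≢⊥ _     = contradiction refl []≢⊥
p≢⊥∧∣p∣≢1⇒pair {p = true ∷ p}  _    ∣p∣≢1
  with y , y∈p ← p≢⊥⇒Nonempty {p = p} (∣p∣≢1 ∘ cong suc ∘ p≡⊥⇒∣p∣≡0)
  = zero , suc y , (λ ()) , here , there y∈p
p≢⊥∧∣p∣≢1⇒pair {p = false ∷ p} p≢⊥  ∣p∣≢1
  with x , y , x≢y , x∈p , y∈p ← p≢⊥∧∣p∣≢1⇒pair (p≢⊥ ∘ cong (false ∷_)) ∣p∣≢1
  = suc x , suc y , x≢y ∘ Finₚ.suc-injective , there x∈p , there y∈p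

suc∣p-x∣≡∣p∣ : x ∈ p → suc ∣ p - x ∣ ≡ ∣ p ∣
suc∣p-x∣≡∣p∣ {p = true  ∷ p} here        = cong (suc ∘ ∣_∣) (p─⊥≡p p)
suc∣p-x∣≡∣p∣ {p = true  ∷ p} (there x∈p) = cong suc (suc∣p-x∣≡∣p∣ x∈p)
suc∣p-x∣≡∣p∣ {p = false ∷ p} (there x∈p) = suc∣p-x∣≡∣p∣ x∈p

x∈p─q⇒x∉q : x ∈ p ─ q → x ∉ q
x∈p─q⇒x∉q {p = true ∷ p} {q = false ∷ q} here        ()
x∈p─q⇒x∉q {p = s ∷ p}    {q = t ∷ q}     (there x∈p) (there x∈q) = x∈p─q⇒x∉q x∈p x∈q

p─p≡⊥ : ∀ (p : Subset n) → p ─ p ≡ ⊥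
p─p≡⊥ []          = refl
p─p≡⊥ (true  ∷ p) = cong (false ∷_) (p─p≡⊥ p)
p─p≡⊥ (false ∷ p) = cong (false ∷_) (p─p≡⊥ p)

p⊆q⇒p∩q≡p : p ⊆ q → p ∩ q ≡ p
p⊆q⇒p∩q≡p {p = p} {q} p⊆q = ⊆-antisym (p∩q⊆p p q) (λ x∈p → x∈p∩q⁺ (x∈p , p⊆q x∈p))

p∩q≡p⇒p⊆q : p ∩ q ≡ p → p ⊆ q
p∩q≡p⇒p⊆q {p = p} {q} p∩q≡p x∈p = p∩q⊆q p q (subst (_ ∈_) (sym p∩q≡p) x∈p)

⁅x⁆⊆p⇔x∈p : ⁅ x ⁆ ⊆ p ⇔ x ∈ p
⁅x⁆⊆p⇔x∈p {x = x} {p = p} = mk⇔ (λ ⁅x⁆⊆p → ⁅x⁆⊆p (x∈⁅x⁆ x))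
  (λ x∈p {y} y∈⁅x⁆ → subst (_∈ p) (sym (x∈⁅y⁆⇒x≡y x y∈⁅x⁆)) x∈p)

p⊆⁅x⁆⇒p≡⊥⊎p≡⁅x⁆ : p ⊆ ⁅ x ⁆ → p ≡ ⊥ ⊎ p ≡ ⁅ x ⁆
p⊆⁅x⁆⇒p≡⊥⊎p≡⁅x⁆ {p = p} {x} p⊆⁅x⁆ with nonempty? p
... | no  p-empty   = inj₁ (Empty-unique p-empty)
... | yes (y , y∈p) = inj₂ (⊆-antisym p⊆⁅x⁆ (Equivalence.from ⁅x⁆⊆p⇔x∈p x∈p))
  where x∈p = subst (_∈ p) (x∈⁅y⁆⇒x≡y x (p⊆⁅x⁆ y∈p)) y∈p

p∩q≡⊥⇔disjoint : p ∩ q ≡ ⊥ ⇔ (∀ {x} → x ∈ p → x ∉ q)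
p∩q≡⊥⇔disjoint {p = p} {q} = mk⇔ to from
  where
  to : p ∩ q ≡ ⊥ → ∀ {x} → x ∈ p → x ∉ q
  to p∩q≡⊥ x∈p x∈q = ∉⊥ (subst (_ ∈_) p∩q≡⊥ (x∈p∩q⁺ (x∈p , x∈q)))
  from : (∀ {x} → x ∈ p → x ∉ q) → p ∩ q ≡ ⊥
  from disjoint = Empty-unique λ (_ , x∈p∩q) → uncurry disjoint (x∈p∩q⁻ p q x∈p∩q)

⁅x⁆∩[p-x]≡⊥ : ∀ (p : Subset n) x → ⁅ x ⁆ ∩ (p - x) ≡ ⊥
⁅x⁆∩[p-x]≡⊥ p x = Equivalence.from p∩q≡⊥⇔disjoint (λ y∈⁅x⁆ y∈p-x → x∈p─q⇒x∉q y∈p-x y∈⁅x⁆)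

⁅x⁆∪[p-x]≡p : x ∈ p → ⁅ x ⁆ ∪ (p - x) ≡ p
⁅x⁆∪[p-x]≡p {x = x} {p = p} x∈p = ⊆-antisym ∪⊆p p⊆∪
  where
  ∪⊆p : ⁅ x ⁆ ∪ (p - x) ⊆ p
  ∪⊆p y∈∪ with x∈p∪q⁻ ⁅ x ⁆ (p - x) y∈∪
  ... | inj₁ y∈⁅x⁆ = subst (_∈ p) (sym (x∈⁅y⁆⇒x≡y x y∈⁅x⁆)) x∈p
  ... | inj₂ y∈p-x = p─q⊆p p ⁅ x ⁆ y∈p-x
  p⊆∪ : p ⊆ ⁅ x ⁆ ∪ (p - x)
  p⊆∪ {y} y∈p with y Fin.≟ x
  ... | yes refl = x∈p∪q⁺ (inj₁ (x∈⁅x⁆ x))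
  ... | no  y≢x  = x∈p∪q⁺ (inj₂ (x∈p∧x≢y⇒x∈p-y y∈p y≢x))

x∈⋃⇔Any : ∀ {ps : List (Subset n)} → x ∈ ⋃ ps ⇔ Any (x ∈_) ps
x∈⋃⇔Any {ps = []}     = mk⇔ (λ x∈⊥ → contradiction x∈⊥ ∉⊥) (λ ())
x∈⋃⇔Any {ps = p ∷ ps} = mk⇔
  ([ Any.here , Any.there ∘ Equivalence.to x∈⋃⇔Any ]′ ∘ x∈p∪q⁻ p (⋃ ps))
  (λ { (Any.here  x∈p)  → x∈p∪q⁺ (inj₁ x∈p)
     ; (Any.there x∈ps) → x∈p∪q⁺ (inj₂ (Equivalence.from x∈⋃⇔Any x∈ps)) })

p≡⊤⇔∀x∈p : p ≡ ⊤ ⇔ (∀ x → x ∈ p)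
p≡⊤⇔∀x∈p = mk⇔ (λ { refl x → ∈⊤ }) (λ ∀x∈p → ⊆-antisym ⊆⊤ λ {x} _ → ∀x∈p x)

∈-allSubsets : ∀ {k} (A : Subset k) → A ∈ₗ allSubsets k
∈-allSubsets []                  = Any.here refl
∈-allSubsets         (true  ∷ A) = ∈-++⁺ˡ (∈-map⁺ (true ∷_) (∈-allSubsets A))
∈-allSubsets {suc k} (false ∷ A) =
  ∈-++⁺ʳ (map (true ∷_) (allSubsets k)) (∈-map⁺ (false ∷_) (∈-allSubsets A))

∑-indicator : ∀ {k} (U : Subset k) c →
              ∑ (allFin k) (λ x → if does (x ∈? U) then c else 0ℚ) ≡ fromℕ ∣ U ∣ * c
∑-indicator []          c = sym (ℚₚ.*-zeroˡ c)
∑-indicator (true ∷ U)  c = begin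
  ∑ (allFin _) (χ (true ∷ U))  ≡⟨ ∑-allFin-suc (χ (true ∷ U)) ⟩
  c + ∑ (allFin _) (χ U)       ≡⟨ cong (c +_) (∑-indicator U c) ⟩
  c + fromℕ ∣ U ∣ * c          ≡⟨ cong (_+ fromℕ ∣ U ∣ * c) (ℚₚ.*-identityˡ c) ⟨
  1ℚ * c + fromℕ ∣ U ∣ * c     ≡⟨ ℚₚ.*-distribʳ-+ c 1ℚ (fromℕ ∣ U ∣) ⟨
  (1ℚ + fromℕ ∣ U ∣) * c       ≡⟨ cong (_* c) (fromℕ-+ 1 ∣ U ∣) ⟨
  fromℕ (suc ∣ U ∣) * c        ∎
  where
  open ≡-Reasoning
  χ : Subset n → Fin n → ℚ
  χ V x = if does (x ∈? V) then c else 0ℚ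
∑-indicator (false ∷ U) c =
  trans (∑-allFin-suc (λ x → if does (x ∈? false ∷ U) then c else 0ℚ))
        (trans (ℚₚ.+-identityˡ _) (∑-indicator U c))

∑-empty : ∀ {k} (h : Subset k → ℚ) →
          ∑ (allSubsets k) (λ A → if does (∣ A ∣ ℕ.≟ 0) then h A else 0ℚ) ≡ h ⊥
∑-empty {zero}  h = ℚₚ.+-identityʳ _
∑-empty {suc k} h = begin
  ∑ (map (true ∷_) S ++ map (false ∷_) S) g       ≡⟨ ∑-++ (map (true ∷_) S) _ g ⟩
  ∑ (map (true ∷_) S) g + ∑ (map (false ∷_) S) g
    ≡⟨ cong₂ _+_ (trans (∑-map _ S g) (∑-zero S)) (trans (∑-map _ S g) (∑-empty (h ∘ (false ∷_)))) ⟩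
  0ℚ + h ⊥                                         ≡⟨ ℚₚ.+-identityˡ _ ⟩
  h ⊥                                              ∎
  where
  open ≡-Reasoning
  S = allSubsets k
  g : Subset (suc k) → ℚ
  g A = if does (∣ A ∣ ℕ.≟ 0) then h A else 0ℚ

∑-singletons : ∀ {k} (h : Subset k → ℚ) →
               ∑ (allSubsets k) (λ A → if does (∣ A ∣ ℕ.≟ 1) then h A else 0ℚ) ≡ ∑ (allFin k) (h ∘ ⁅_⁆)
∑-singletons {zero}  h = ℚₚ.+-identityʳ _
∑-singletons {suc k} h = begin
  ∑ (map (true ∷_) S ++ map (false ∷_) S) g       ≡⟨ ∑-++ (map (true ∷_) S) _ g ⟩
  ∑ (map (true ∷_) S) g + ∑ (map (false ∷_) S) g
    ≡⟨ cong₂ _+_ (trans (∑-map _ S g) (∑-empty (h ∘ (true ∷_))))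
                 (trans (∑-map _ S g) (∑-singletons (h ∘ (false ∷_)))) ⟩
  h ⁅ zero ⁆ + ∑ (allFin k) (h ∘ ⁅_⁆ ∘ suc)        ≡⟨ ∑-allFin-suc (h ∘ ⁅_⁆) ⟨
  ∑ (allFin (suc k)) (h ∘ ⁅_⁆)                     ∎
  where
  open ≡-Reasoning
  S = allSubsets k
  g : Subset (suc k) → ℚ
  g A = if does (∣ A ∣ ℕ.≟ 1) then h A else 0ℚ

sumSingletons-∷ : ∀ {k} (f : Subset (suc k) → ℤ) a (A : Subset k) →
  sumSingletons f (a ∷ A) ≡ (if a then f ⁅ zero ⁆ else 0ℤ) ℤ.+ sumSingletons (f ∘ (false ∷_)) A
sumSingletons-∷ f a A = cong sumℤ (map-allFin-suc (λ x → if lookup (a ∷ A) x then f ⁅ x ⁆ else 0ℤ))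

sumSingletons-⊥ : ∀ {k} (f : Subset k → ℤ) → sumSingletons f ⊥ ≡ 0ℤ
sumSingletons-⊥ {zero}  f = refl
sumSingletons-⊥ {suc k} f =
  trans (sumSingletons-∷ f false ⊥) (trans (ℤₚ.+-identityˡ _) (sumSingletons-⊥ (f ∘ (false ∷_))))

sumSingletons-remove : ∀ {k} (f : Subset k → ℤ) {A x} → x ∈ A →
                       sumSingletons f A ≡ f ⁅ x ⁆ ℤ.+ sumSingletons f (A - x)
sumSingletons-remove {suc k} f {true ∷ A} here = begin
  sumSingletons f (true ∷ A)                 ≡⟨ sumSingletons-∷ f true A ⟩
  f₀ ℤ.+ sumSingletons f′ A                   ≡⟨ cong (λ B → f₀ ℤ.+ sumSingletons f′ B) (p─⊥≡p A) ⟨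
  f₀ ℤ.+ sumSingletons f′ (A ─ ⊥)             ≡⟨ cong (ℤ._+_ f₀) (ℤₚ.+-identityˡ _) ⟨
  f₀ ℤ.+ (0ℤ ℤ.+ sumSingletons f′ (A ─ ⊥))    ≡⟨ cong (ℤ._+_ f₀) (sumSingletons-∷ f false (A ─ ⊥)) ⟨
  f₀ ℤ.+ sumSingletons f ((true ∷ A) - zero)  ∎
  where
  open ≡-Reasoning
  f₀ = f ⁅ zero ⁆
  f′ = f ∘ (false ∷_)
sumSingletons-remove {suc k} f {a ∷ A} {suc x} (there x∈A) = begin
  sumSingletons f (a ∷ A)                           ≡⟨ sumSingletons-∷ f a A ⟩
  fa ℤ.+ sumSingletons f′ A                          ≡⟨ cong (ℤ._+_ fa) (sumSingletons-remove f′ x∈A) ⟩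
  fa ℤ.+ (f ⁅ suc x ⁆ ℤ.+ sumSingletons f′ (A - x))  ≡⟨ x∙yz≈y∙xz fa (f ⁅ suc x ⁆) _ ⟩
  f ⁅ suc x ⁆ ℤ.+ (fa ℤ.+ sumSingletons f′ (A - x))  ≡⟨ cong (ℤ._+_ (f ⁅ suc x ⁆)) (sumSingletons-∷ f a (A - x)) ⟨
  f ⁅ suc x ⁆ ℤ.+ sumSingletons f ((a ∷ A) - suc x)  ∎
  where
  open ≡-Reasoning
  open import Algebra.Properties.CommutativeSemigroup ℤₚ.+-commutativeSemigroup using (x∙yz≈y∙xz)
  f′ = f ∘ (false ∷_)
  fa = if a then f ⁅ zero ⁆ else 0ℤ

sumSingletons-⁅⁆ : ∀ {k} (f : Subset k → ℤ) x → sumSingletons f ⁅ x ⁆ ≡ f ⁅ x ⁆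
sumSingletons-⁅⁆ f x = begin
  sumSingletons f ⁅ x ⁆                    ≡⟨ sumSingletons-remove f (x∈⁅x⁆ x) ⟩
  f ⁅ x ⁆ ℤ.+ sumSingletons f (⁅ x ⁆ - x)  ≡⟨ cong (λ A → f ⁅ x ⁆ ℤ.+ sumSingletons f A) (p─p≡⊥ ⁅ x ⁆) ⟩
  f ⁅ x ⁆ ℤ.+ sumSingletons f ⊥            ≡⟨ cong (ℤ._+_ (f ⁅ x ⁆)) (sumSingletons-⊥ f) ⟩
  f ⁅ x ⁆ ℤ.+ 0ℤ                           ≡⟨ ℤₚ.+-identityʳ _ ⟩
  f ⁅ x ⁆                                  ∎
  where open ≡-Reasoning

module _ {k : ℕ} (f : Subset k → ℤ) where

  modularOn⇔ : ∀ Y → T (allB (λ A → ⌊ f A ℤ.≟ sumSingletons f A ⌋) (subsetsOf Y)) ⇔ ModularOn f Y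
  modularOn⇔ Y = ⇔.trans (T-allB (subsetsOf Y)) (mk⇔
    (λ all A A∩Y≡A → toWitness (All.lookup all (∈-filter⁺ ⊆Y? (∈-allSubsets A) A∩Y≡A)))
    (λ modular → All.tabulate λ {A} A∈ →
       fromWitness (modular A (proj₂ (∈-filter⁻ ⊆Y? {xs = allSubsets k} A∈)))))
    where ⊆Y? = λ A → (A ∩ Y) ≟ₛ A

  -- εδ f Y unfolds to  if does (modularOn? Y) then 1ℚ else 0ℚ,  as Dec.map and T? keep `does`.
  modularOn? : ∀ Y → Dec (ModularOn f Y)
  modularOn? Y = Dec.map (modularOn⇔ Y) (T? _)

  εδ-modular : ∀ {Y} → ModularOn f Y → εδ f Y ≡ 1ℚ
  εδ-modular {Y} modular = cong (if_then 1ℚ else 0ℚ) (dec-true (modularOn? Y) modular)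

  εδ-nonmodular : ∀ {Y} → ¬ ModularOn f Y → εδ f Y ≡ 0ℚ
  εδ-nonmodular {Y} ¬modular = cong (if_then 1ℚ else 0ℚ) (dec-false (modularOn? Y) ¬modular)

  modularOn-⊆ : ∀ {Y A} → ModularOn f Y → A ⊆ Y → f A ≡ sumSingletons f A
  modularOn-⊆ modular A⊆Y = modular _ (p⊆q⇒p∩q≡p A⊆Y)

  modularOn-remove : ∀ {Y x} → ModularOn f Y → x ∈ Y → f Y ≡ f ⁅ x ⁆ ℤ.+ f (Y - x)
  modularOn-remove {Y} {x} modular x∈Y = begin
    f Y                                  ≡⟨ modularOn-⊆ modular id ⟩
    sumSingletons f Y                    ≡⟨ sumSingletons-remove f x∈Y ⟩
    f ⁅ x ⁆ ℤ.+ sumSingletons f (Y - x)  ≡⟨ cong (ℤ._+_ (f ⁅ x ⁆)) (modularOn-⊆ modular (p─q⊆p Y ⁅ x ⁆)) ⟨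
    f ⁅ x ⁆ ℤ.+ f (Y - x)                ∎
    where open ≡-Reasoning

  modularOn-⁅⁆ : f ⊥ ≡ 0ℤ → ∀ x → ModularOn f ⁅ x ⁆
  modularOn-⁅⁆ f⊥≡0 x A A∩⁅x⁆≡A with p⊆⁅x⁆⇒p≡⊥⊎p≡⁅x⁆ (p∩q≡p⇒p⊆q A∩⁅x⁆≡A)
  ... | inj₁ refl = trans f⊥≡0 (sym (sumSingletons-⊥ f))
  ... | inj₂ refl = sym (sumSingletons-⁅⁆ f x)

record SingletonWeight {k} (w : Subset k → ℚ) : Set where
  field
    on-singleton : ∀ x → w ⁅ x ⁆ ≡ 1ℚ
    on-pair      : ∀ {A x y} → x ≢ y → x ∈ A → y ∈ A → w A ≡ 0ℚ

εδ-singletonWeight : ∀ {k} {f : Subset k → ℤ} → f ⊥ ≡ 0ℤ →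
  (∀ A B → Nonempty A → Nonempty B → A ∩ B ≡ ⊥ → f (A ∪ B) ≢ f A ℤ.+ f B) →
  SingletonWeight (εδ f)
εδ-singletonWeight {f = f} f⊥≡0 rigid = record
  { on-singleton = λ x → εδ-modular f (modularOn-⁅⁆ f f⊥≡0 x)
  ; on-pair      = λ {A} {x} {y} x≢y x∈A y∈A → εδ-nonmodular f λ modular →
      rigid ⁅ x ⁆ (A - x) (x , x∈⁅x⁆ x) (y , x∈p∧x≢y⇒x∈p-y y∈A (x≢y ∘ sym)) (⁅x⁆∩[p-x]≡⊥ A x)
            (trans (cong f (⁅x⁆∪[p-x]≡p x∈A)) (modularOn-remove f modular x∈A))
  }

-- Relative to an arbitrary ground set U (isOrderedPartition is the case U = ⊤), so that the
-- remaining blocks after the first one A form an ordered partition of U ─ A.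
record OrderedPartition {k m} (U : Subset k) (Xs : Vec (Subset k) m) : Set where
  field
    nonempty : ∀ i → lookup Xs i ≢ ⊥
    disjoint : ∀ {i j} → i ≢ j → lookup Xs i ∩ lookup Xs j ≡ ⊥
    covering : ∀ {x} → x ∈ U → ∃ λ i → x ∈ lookup Xs i
    within   : ∀ i → lookup Xs i ⊆ U

module _ {k : ℕ} where

  OrderedPartition-[] : ∀ {U : Subset k} → OrderedPartition U [] ⇔ ∣ U ∣ ≡ 0
  OrderedPartition-[] = mk⇔
    (λ P → p≡⊥⇒∣p∣≡0 (Empty-unique λ (_ , x∈U) → Finₚ.¬Fin0 (proj₁ (OrderedPartition.covering P x∈U))))
    (λ ∣U∣≡0 → record
      { nonempty = λ ()
      ; disjoint = λ {i} → ⊥-elim (Finₚ.¬Fin0 i)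
      ; covering = λ x∈U → contradiction (subst (_ ∈_) (∣p∣≡0⇒p≡⊥ ∣U∣≡0) x∈U) ∉⊥
      ; within   = λ ()
      })

  OrderedPartition-∷ : ∀ {m} {U A : Subset k} {Xs : Vec (Subset k) m} →
                       OrderedPartition U (A ∷ Xs) ⇔ (A ≢ ⊥ × A ⊆ U × OrderedPartition (U ─ A) Xs)
  OrderedPartition-∷ {U = U} {A} {Xs} = mk⇔ to from
    where
    module Disjoint {n} {p q : Subset n} = Equivalence (p∩q≡⊥⇔disjoint {p = p} {q})

    to : OrderedPartition U (A ∷ Xs) → A ≢ ⊥ × A ⊆ U × OrderedPartition (U ─ A) Xs
    to P = nonempty zero , within zero , record
      { nonempty = nonempty ∘ suc
      ; disjoint = λ i≢j → disjoint (i≢j ∘ Finₚ.suc-injective)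
      ; covering = covering′
      ; within   = within′
      }
      where
      open OrderedPartition P
      covering′ : ∀ {x} → x ∈ U ─ A → ∃ λ i → x ∈ lookup Xs i
      covering′ x∈U─A with covering (p─q⊆p U A x∈U─A)
      ... | zero  , x∈A = contradiction x∈A (x∈p─q⇒x∉q x∈U─A)
      ... | suc i , x∈X = i , x∈X
      within′ : ∀ i → lookup Xs i ⊆ U ─ A
      within′ i x∈X = x∈p∧x∉q⇒x∈p─q (within (suc i) x∈X)
                                     (λ x∈A → Disjoint.to (disjoint {zero} {suc i} (λ ())) x∈A x∈X)

    from : A ≢ ⊥ × A ⊆ U × OrderedPartition (U ─ A) Xs → OrderedPartition U (A ∷ Xs)
    from (A≢⊥ , A⊆U , P) = record
      { nonempty = λ { zero → A≢⊥ ; (suc i) → nonempty i }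
      ; disjoint = disjoint′
      ; covering = covering′
      ; within   = λ { zero → A⊆U ; (suc i) → p─q⊆p U A ∘ within i }
      }
      where
      open OrderedPartition P
      disjoint′ : ∀ {i j} → i ≢ j → lookup (A ∷ Xs) i ∩ lookup (A ∷ Xs) j ≡ ⊥
      disjoint′ {zero}  {zero}  i≢j = contradiction refl i≢j
      disjoint′ {zero}  {suc j} _   = Disjoint.from λ x∈A x∈X → x∈p─q⇒x∉q (within j x∈X) x∈A
      disjoint′ {suc i} {zero}  _   = Disjoint.from λ x∈X x∈A → x∈p─q⇒x∉q (within i x∈X) x∈A
      disjoint′ {suc i} {suc j} i≢j = disjoint (i≢j ∘ cong suc)
      covering′ : ∀ {x} → x ∈ U → ∃ λ i → x ∈ lookup (A ∷ Xs) i
      covering′ {x} x∈U with x ∈? A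
      ... | yes x∈A = zero , x∈A
      ... | no  x∉A = Product.map suc id (covering (x∈p∧x∉q⇒x∈p─q x∈U x∉A))

  orderedPartition? : ∀ {m} (U : Subset k) (Xs : Vec (Subset k) m) → Dec (OrderedPartition U Xs)
  orderedPartition? U []       = Dec.map (⇔.sym OrderedPartition-[]) (∣ U ∣ ℕ.≟ 0)
  orderedPartition? U (A ∷ Xs) =
    Dec.map (⇔.sym OrderedPartition-∷) (¬? (A ≟ₛ ⊥) ×-dec A ⊆? U ×-dec orderedPartition? (U ─ A) Xs)

module _ {k j : ℕ} (Xs : Vec (Subset k) j) where

  private
    X = lookup Xs

  OrderedPartition-⊤ : OrderedPartition ⊤ Xs ⇔
    ((∀ i → X i ≢ ⊥) × (∀ {i i′} → i ≢ i′ → X i ∩ X i′ ≡ ⊥) × (∀ x → ∃ λ i → x ∈ X i))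
  OrderedPartition-⊤ = mk⇔
    (λ P → let open OrderedPartition P in nonempty , (λ {i} {i′} → disjoint {i} {i′}) , λ _ → covering ∈⊤)
    (λ (nonempty , disjoint , covers) → record
      { nonempty = nonempty ; disjoint = disjoint ; covering = λ {x} _ → covers x ; within = λ _ → ⊆⊤ })

  isOrderedPartition⇔ : isOrderedPartition Xs ≡ true ⇔ OrderedPartition ⊤ Xs
  isOrderedPartition⇔ =
    ⇔.trans (⇔.sym T-≡) (⇔.trans T-∧ (⇔.trans (nonempty⇔ ×-⇔ ⇔.trans T-∧ (disjoint⇔ ×-⇔ covering⇔))
                                               (⇔.sym OrderedPartition-⊤)))
    where
    nonempty⇔ : T (allB (λ i → not ⌊ X i ≟ₛ ⊥ ⌋) (allFin j)) ⇔ (∀ i → X i ≢ ⊥)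
    nonempty⇔ = ⇔.trans (T-allB-allFin _) (mk⇔ (λ h → toWitnessFalse ∘ h) (λ h → fromWitnessFalse ∘ h))

    Cell : Fin j → Fin j → Bool
    Cell i i′ = ⌊ i Fin.≟ i′ ⌋ ∨ ⌊ (X i ∩ X i′) ≟ₛ ⊥ ⌋

    cell⇔ : ∀ i i′ → T (Cell i i′) ⇔ (i ≡ i′ ⊎ X i ∩ X i′ ≡ ⊥)
    cell⇔ i i′ = ⇔.trans (T-∨ {⌊ i Fin.≟ i′ ⌋})
      (mk⇔ (Sum.map toWitness toWitness) (Sum.map fromWitness fromWitness))

    disjoint⇔ : T (allB (λ i → allB (Cell i) (allFin j)) (allFin j)) ⇔ (∀ {i i′} → i ≢ i′ → X i ∩ X i′ ≡ ⊥)
    disjoint⇔ = ⇔.trans (T-allB-allFin _) (mk⇔ to from)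
      where
      to : (∀ i → T (allB (Cell i) (allFin j))) → ∀ {i i′} → i ≢ i′ → X i ∩ X i′ ≡ ⊥
      to h {i} {i′} i≢i′ =
        [ flip contradiction i≢i′ , id ]′
          (Equivalence.to (cell⇔ i i′) (Equivalence.to (T-allB-allFin _) (h i) i′))
      from : (∀ {i i′} → i ≢ i′ → X i ∩ X i′ ≡ ⊥) → ∀ i → T (allB (Cell i) (allFin j))
      from h i = Equivalence.from (T-allB-allFin _) λ i′ → Equivalence.from (cell⇔ i i′) (decide i′)
        where
        decide : ∀ i′ → i ≡ i′ ⊎ X i ∩ X i′ ≡ ⊥
        decide i′ with i Fin.≟ i′
        ... | yes i≡i′ = inj₁ i≡i′
        ... | no  i≢i′ = inj₂ (h i≢i′)

    covering⇔ : T ⌊ ⋃ (map X (allFin j)) ≟ₛ ⊤ ⌋ ⇔ (∀ x → ∃ λ i → x ∈ X i)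
    covering⇔ = ⇔.trans (mk⇔ toWitness fromWitness) (⇔.trans p≡⊤⇔∀x∈p
      (mk⇔ (λ h x → Any.tabulate⁻ (Any.map⁻ (Equivalence.to x∈⋃⇔Any (h x))))
           (λ h x → Equivalence.from x∈⋃⇔Any (Any.map⁺ (uncurry Any.tabulate⁺ (h x))))))

module WeightedPartitions {k : ℕ} (w : Subset k → ℚ) where

  weight : ∀ {m} → Vec (Subset k) m → ℚ
  weight []       = 1ℚ
  weight (A ∷ Xs) = w A * weight Xs

  weightedPartitions : Subset k → ℕ → ℚ
  weightedPartitions U m = ∑ (allTuples m) λ Xs → if does (orderedPartition? U Xs) then weight Xs else 0ℚ

  prodℚ-map-lookup : ∀ {m} (Xs : Vec (Subset k) m) → prodℚ (map (w ∘ lookup Xs) (allFin m)) ≡ weight Xs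
  prodℚ-map-lookup []       = refl
  prodℚ-map-lookup (A ∷ Xs) =
    trans (cong prodℚ (map-allFin-suc (w ∘ lookup (A ∷ Xs)))) (cong (w A *_) (prodℚ-map-lookup Xs))

  weightedPartitions-⊤ : ∀ m →
    ∑ (orderedPartitions k m) (λ Xs → prodℚ (map (w ∘ lookup Xs) (allFin m))) ≡ weightedPartitions ⊤ m
  weightedPartitions-⊤ m = trans (∑-filter (λ Xs → isOrderedPartition Xs Boolₚ.≟ true) (allTuples m) _)
    (∑-cong (allTuples m) λ {Xs} _ → cong₂ (λ b r → if b then r else 0ℚ)
       (does-⇔ (isOrderedPartition⇔ Xs) (isOrderedPartition Xs Boolₚ.≟ true) (orderedPartition? ⊤ Xs))
       (prodℚ-map-lookup Xs))

  weightedPartitions-zero : ∀ U → weightedPartitions U 0 ≡ (if does (∣ U ∣ ℕ.≟ 0) then 1ℚ else 0ℚ)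
  weightedPartitions-zero U = ℚₚ.+-identityʳ _

  weightedPartitions-suc : ∀ U m → weightedPartitions U (suc m) ≡
    ∑ (allSubsets k) (λ A → (if does (¬? (A ≟ₛ ⊥)) then w A else 0ℚ) *
                            (if does (A ⊆? U) then weightedPartitions (U ─ A) m else 0ℚ))
  weightedPartitions-suc U m = begin
    ∑ (concatMap (λ A → map (A ∷_) (allTuples m)) (allSubsets k)) χ
      ≡⟨ ∑-concatMap (λ A → map (A ∷_) (allTuples m)) (allSubsets k) χ ⟩
    ∑ (allSubsets k) (λ A → ∑ (map (A ∷_) (allTuples m)) χ)
      ≡⟨ ∑-cong (allSubsets k) (λ {A} _ → first-block A) ⟩
    ∑ (allSubsets k) (λ A → nonemptyWeight A * rest A)
      ∎
    where
    open ≡-Reasoning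
    χ : Vec (Subset k) (suc m) → ℚ
    χ Xs = if does (orderedPartition? U Xs) then weight Xs else 0ℚ

    nonemptyWeight rest : Subset k → ℚ
    nonemptyWeight A = if does (¬? (A ≟ₛ ⊥)) then w A else 0ℚ
    rest A = if does (A ⊆? U) then weightedPartitions (U ─ A) m else 0ℚ

    χ-rest : Subset k → Vec (Subset k) m → ℚ
    χ-rest A Xs = if does (A ⊆? U) ∧ does (orderedPartition? (U ─ A) Xs) then weight Xs else 0ℚ

    ∑-χ-rest : ∀ A → ∑ (allTuples m) (χ-rest A) ≡ rest A
    ∑-χ-rest A with does (A ⊆? U)
    ... | true  = refl
    ... | false = ∑-zero (allTuples m)

    -- χ (A ∷ Xs) computes to the conjunction of the three tests made by orderedPartition?.
    first-block : ∀ A → ∑ (map (A ∷_) (allTuples m)) χ ≡ nonemptyWeight A * rest A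
    first-block A = begin
      ∑ (map (A ∷_) (allTuples m)) χ
        ≡⟨ ∑-map (A ∷_) (allTuples m) χ ⟩
      ∑ (allTuples m) (χ ∘ (A ∷_))
        ≡⟨ ∑-cong (allTuples m) (λ {Xs} _ → if-∧-* (does (¬? (A ≟ₛ ⊥))) _ (w A) (weight Xs)) ⟩
      ∑ (allTuples m) (λ Xs → nonemptyWeight A * χ-rest A Xs)
        ≡⟨ ∑-*ˡ (allTuples m) (nonemptyWeight A) (χ-rest A) ⟩
      nonemptyWeight A * ∑ (allTuples m) (χ-rest A)
        ≡⟨ cong (nonemptyWeight A *_) (∑-χ-rest A) ⟩
      nonemptyWeight A * rest A
        ∎

  module _ (singletonWeight : SingletonWeight w) where
    open SingletonWeight singletonWeight

    w-nonempty : ∀ A → (if does (¬? (A ≟ₛ ⊥)) then w A else 0ℚ) ≡ (if does (∣ A ∣ ℕ.≟ 1) then 1ℚ else 0ℚ)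
    w-nonempty A = by-cases (A ≟ₛ ⊥) (∣ A ∣ ℕ.≟ 1)
      where
      by-cases : (A≟⊥ : Dec (A ≡ ⊥)) (∣A∣≟1 : Dec (∣ A ∣ ≡ 1)) →
                 (if does (¬? A≟⊥) then w A else 0ℚ) ≡ (if does ∣A∣≟1 then 1ℚ else 0ℚ)
      by-cases (yes refl) (yes ∣⊥∣≡1) = contradiction (trans (sym (∣⊥∣≡0 k)) ∣⊥∣≡1) ℕₚ.0≢1+n
      by-cases (yes refl) (no  _)     = refl
      by-cases (no  A≢⊥)  (yes ∣A∣≡1) =
        let x , A≡⁅x⁆ = ∣p∣≡1⇒p≡⁅x⁆ ∣A∣≡1 in trans (cong w A≡⁅x⁆) (on-singleton x)
      by-cases (no  A≢⊥)  (no  ∣A∣≢1) =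
        let x , y , x≢y , x∈A , y∈A = p≢⊥∧∣p∣≢1⇒pair A≢⊥ ∣A∣≢1 in on-pair x≢y x∈A y∈A

    weightedPartitions-singletons : ∀ m U →
      weightedPartitions U m ≡ (if does (∣ U ∣ ℕ.≟ m) then fromℕ (m !) else 0ℚ)
    weightedPartitions-singletons zero    U = weightedPartitions-zero U
    weightedPartitions-singletons (suc m) U = begin
      N U (suc m)
        ≡⟨ weightedPartitions-suc U m ⟩
      ∑ (allSubsets k) (λ A → (if does (¬? (A ≟ₛ ⊥)) then w A else 0ℚ) * rest A)
        ≡⟨ ∑-cong (allSubsets k) (λ {A} _ → singleton-block A) ⟩
      ∑ (allSubsets k) (λ A → if does (∣ A ∣ ℕ.≟ 1) then rest A else 0ℚ)
        ≡⟨ ∑-singletons rest ⟩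
      ∑ (allFin k) (λ x → if does (⁅ x ⁆ ⊆? U) then N (U - x) m else 0ℚ)
        ≡⟨ ∑-cong (allFin k) (λ {x} _ → remove-point x) ⟩
      ∑ (allFin k) (λ x → if does (x ∈? U) then c else 0ℚ)
        ≡⟨ ∑-indicator U c ⟩
      fromℕ ∣ U ∣ * c
        ≡⟨ count-step (∣ U ∣ ℕ.≟ suc m) ⟩
      (if does (∣ U ∣ ℕ.≟ suc m) then fromℕ (suc m !) else 0ℚ)
        ∎
      where
      open ≡-Reasoning
      N = weightedPartitions

      rest : Subset k → ℚ
      rest A = if does (A ⊆? U) then N (U ─ A) m else 0ℚ

      c : ℚ
      c = if does (∣ U ∣ ℕ.≟ suc m) then fromℕ (m !) else 0ℚ

      singleton-block : ∀ A → (if does (¬? (A ≟ₛ ⊥)) then w A else 0ℚ) * rest A ≡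
                              (if does (∣ A ∣ ℕ.≟ 1) then rest A else 0ℚ)
      singleton-block A = trans (cong (_* rest A) (w-nonempty A))
        (trans (if-*ʳ (does (∣ A ∣ ℕ.≟ 1)) 1ℚ (rest A))
               (cong (if does (∣ A ∣ ℕ.≟ 1) then_else 0ℚ) (ℚₚ.*-identityˡ (rest A))))

      remove-point : ∀ x → (if does (⁅ x ⁆ ⊆? U) then N (U - x) m else 0ℚ) ≡ (if does (x ∈? U) then c else 0ℚ)
      remove-point x =
        trans (cong (if_then N (U - x) m else 0ℚ) (does-⇔ ⁅x⁆⊆p⇔x∈p (⁅ x ⁆ ⊆? U) (x ∈? U))) (by-cases (x ∈? U))
        where
        by-cases : (x∈?U : Dec (x ∈ U)) → (if does x∈?U then N (U - x) m else 0ℚ) ≡ (if does x∈?U then c else 0ℚ)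
        by-cases (yes x∈U) = trans (weightedPartitions-singletons m (U - x))
          (cong (λ n → if does (n ℕ.≟ suc m) then fromℕ (m !) else 0ℚ) (suc∣p-x∣≡∣p∣ x∈U))
        by-cases (no  _)   = refl

      count-step : ∀ {n} (n≟1+m : Dec (n ≡ suc m)) →
        fromℕ n * (if does n≟1+m then fromℕ (m !) else 0ℚ) ≡ (if does n≟1+m then fromℕ (suc m !) else 0ℚ)
      count-step     (yes refl) = sym (fromℕ-* (suc m) (m !))
      count-step {n} (no  _)    = ℚₚ.*-zeroʳ (fromℕ n)

coeff-Φ : ∀ {k} (f : Subset k → ℤ) n → let open WeightedPartitions (εδ f) in
  coeff (Φ f) n ≡ ∑ (upTo k) (λ j → weightedPartitions ⊤ (suc j) * coeff (binomT (suc j)) n)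
coeff-Φ {k} f n = begin
  coeff (Φ f) n                                    ≡⟨ coeff-sumₚ (map (term ∘ suc) (upTo k)) n ⟩
  ∑ (map (term ∘ suc) (upTo k)) (λ p → coeff p n)  ≡⟨ ∑-map (term ∘ suc) (upTo k) (λ p → coeff p n) ⟩
  ∑ (upTo k) (λ j → coeff (term (suc j)) n)        ≡⟨ ∑-cong (upTo k) (λ {j} _ → coeff-term (suc j)) ⟩
  ∑ (upTo k) (λ j → weightedPartitions ⊤ (suc j) * coeff (binomT (suc j)) n) ∎
  where
  open ≡-Reasoning
  open WeightedPartitions (εδ f)

  P : ∀ {m} → Vec (Subset k) m → ℚ
  P {m} Xs = prodℚ (map (εδ f ∘ lookup Xs) (allFin m))

  summand : ∀ {m} → Vec (Subset k) m → Poly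
  summand {m} Xs = scale (P Xs) (binomT m)

  term : ℕ → Poly
  term m = sumₚ (map summand (orderedPartitions k m))

  coeff-term : ∀ m → coeff (term m) n ≡ weightedPartitions ⊤ m * coeff (binomT m) n
  coeff-term m = begin
    coeff (term m) n                          ≡⟨ coeff-sumₚ (map summand Xss) n ⟩
    ∑ (map summand Xss) (λ p → coeff p n)     ≡⟨ ∑-map summand Xss (λ p → coeff p n) ⟩
    ∑ Xss (λ Xs → coeff (summand Xs) n)       ≡⟨ ∑-cong Xss (λ {Xs} _ → coeff-scale (P Xs) (binomT m) n) ⟩
    ∑ Xss (λ Xs → P Xs * coeff (binomT m) n)  ≡⟨ ∑-*ʳ Xss (coeff (binomT m) n) P ⟩
    ∑ Xss P * coeff (binomT m) n              ≡⟨ cong (_* coeff (binomT m) n) (weightedPartitions-⊤ m) ⟩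
    weightedPartitions ⊤ m * coeff (binomT m) n ∎
    where Xss = orderedPartitions k m

proposition5p3 : (k : ℕ) (f : Subset k → ℤ) → f ⊥ ≡ 0ℤ →
    HyperRigid f → Φ f ≈ₚ fallingFactorial k
proposition5p3 zero    f _    ((() , _) , _)
proposition5p3 (suc k) f f⊥≡0 (_ , rigid) n = begin
  coeff (Φ f) n
    ≡⟨ coeff-Φ f n ⟩
  ∑ (upTo (suc k)) (λ j → weightedPartitions ⊤ (suc j) * coeff (binomT (suc j)) n)
    ≡⟨ ∑-cong (upTo (suc k)) (λ {j} _ → count-term j) ⟩
  ∑ (upTo (suc k)) (λ j → if does (k ℕ.≟ j) then fromℕ (suc j !) * coeff (binomT (suc j)) n else 0ℚ)
    ≡⟨ ∑-upTo-≟ k (λ j → fromℕ (suc j !) * coeff (binomT (suc j)) n) ⟩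
  fromℕ (suc k !) * coeff (binomT (suc k)) n
    ≡⟨ fromℕ[k!]*binomT (suc k) n ⟩
  coeff (fallingFactorial (suc k)) n
    ∎
  where
  open ≡-Reasoning
  open WeightedPartitions (εδ f)

  count : ∀ m → weightedPartitions ⊤ m ≡ (if does (suc k ℕ.≟ m) then fromℕ (m !) else 0ℚ)
  count m = trans (weightedPartitions-singletons (εδ-singletonWeight f⊥≡0 rigid) m ⊤)
                  (cong (λ n → if does (n ℕ.≟ m) then fromℕ (m !) else 0ℚ) (∣⊤∣≡n (suc k)))

  count-term : ∀ j → weightedPartitions ⊤ (suc j) * coeff (binomT (suc j)) n ≡
                     (if does (k ℕ.≟ j) then fromℕ (suc j !) * coeff (binomT (suc j)) n else 0ℚ)
  count-term j = trans (cong (_* coeff (binomT (suc j)) n) (count (suc j)))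
                       (if-*ʳ (does (k ℕ.≟ j)) (fromℕ (suc j !)) (coeff (binomT (suc j)) n))
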